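{- Let $A$ be an arbitrary deterministic and stateless load-balancing algorithm. For every even $n$, there exist a $d$-regular graph on $n$ nodes and an initial load distribution such that $A$ cannot achieve discrepancy better than $c\,d$ (i.e., at every time step the discrepancy is at least $c\,d$), for some positive constant $c>0$.
   Context: Model: on a $d$-regular graph (viewed as symmetric directed), each node $u$ holds $x_t(u)$ indivisible tokens at the beginning of synchronous step $t$; in each step, each node sends some number of tokens along each of its incident edges and keeps the rest (possibly via self-loops/a remainder), and its new load is the number of tokens it kept plus the number received. The discrepancy is $\max_u x_t(u)-\min_u x_t(u)$. An algorithm is deterministic and stateless if, in every step, the numbers of tokens that a node sends along its edges and keeps are determined solely by the node's current load (the assignment of these numbers to particular incident edges being given by the node's local edge labeling, which is not controlled by the algorithm). -}

module Defs where

open import Data.Nat using (ℕ; zero; suc; _+_; _*_; _∸_; _≤_; _⊔_; _⊓_)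
open import Data.Fin using (Fin; zero; suc; _≟_)
open import Data.Product using (∃)
open import Relation.Binary.PropositionalEquality using (_≡_; _≢_)
open import Relation.Nullary.Decidable using (does)
open import Data.Bool using (if_then_else_)

sumF : ∀ {k} → (Fin k → ℕ) → ℕ
sumF {zero}  f = 0
sumF {suc k} f = f zero + sumF (λ i → f (suc i))

-- Maximum over Fin k (0 for k = 0; loads are natural numbers, so this
-- is the usual maximum for k ≥ 1).
maxF : ∀ {k} → (Fin k → ℕ) → ℕ
maxF {zero}  f = 0
maxF {suc k} f = f zero ⊔ maxF (λ i → f (suc i))

-- Minimum over Fin k (0 for k = 0, by convention; only used for k ≥ 1).
minF : ∀ {k} → (Fin k → ℕ) → ℕ
minF {zero}        f = 0
minF {suc zero}    f = f zero
minF {suc (suc k)} f = f zero ⊓ minF (λ i → f (suc i))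

-- A simple d-regular graph on n nodes together with a local edge labeling
-- (port numbering): nbr u i is the neighbour of u reached through u's
-- i-th incident edge.
record RegGraph (n d : ℕ) : Set where
  field
    nbr       : Fin n → Fin d → Fin n
    noLoop    : ∀ u i → nbr u i ≢ u
    injective : ∀ u i j → nbr u i ≡ nbr u j → i ≡ j
    symmetric : ∀ u i → ∃ λ j → nbr (nbr u i) j ≡ u

-- A deterministic stateless algorithm for degree d: a node with load x
-- sends send x i tokens along its i-th incident edge and keeps the rest.
record Algorithm (d : ℕ) : Set where
  field
    send  : ℕ → Fin d → ℕ
    valid : ∀ x → sumF (send x) ≤ x

Load : ℕ → Set
Load n = Fin n → ℕ

step : ∀ {n d} → Algorithm d → RegGraph n d → Load n → Load n
step A G x v =
  (x v ∸ sumF (send (x v)))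
  + sumF (λ u → sumF (λ i → if does (nbr u i ≟ v) then send (x u) i else 0))
  where
    open Algorithm A
    open RegGraph G

run : ∀ {n d} → Algorithm d → RegGraph n d → Load n → ℕ → Load n
run A G x zero    = x
run A G x (suc t) = step A G (run A G x t)

discrepancy : ∀ {n} → Load n → ℕ
discrepancy x = maxF x ∸ minF x

-- Given an algorithm A of degree d and an even n = 2m > d, the adversary takes
-- a circulant graph on the residues modulo n.  Let L = min(⌊d/2⌋, ⌊(m-1)/2⌋),
-- so that d ≤ 4L + 3.  A node holding L tokens sends tokens along at most L of
-- its ports, and the adversary labels the edges so that exactly these "busy"
-- ports carry even shifts.  Then L tokens on every even node and none on the
-- odd nodes is a fixed point of the dynamics, so the discrepancy stays L.  If
-- L = 0 (hence d ≤ 3), a single token keeps the discrepancy at 1 by token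
-- conservation.  Either way d ≤ 7 · discrepancy at all times.
module Submission where

open import Defs
open import Data.Nat
  using (ℕ; zero; suc; _+_; _*_; _∸_; _≤_; _<_; _<?_; _⊓_; _%_; z≤n; s≤s; s≤s⁻¹; z<s;
         NonZero; >-nonZero⁻¹; ⌊_/2⌋; ⌈_/2⌉)
open import Data.Nat.DivMod using (_mod_; m%n<n; %-distribˡ-+; m%n%n≡m%n; [m+n]%n≡m%n; m<n⇒m%n≡m; m∣n⇒o%n%m≡o%m; %-remove-+ʳ)
open import Data.Nat.Divisibility using (_∣_; divides; m∣m*n; n∣m*n; ∣m+n∣m⇒∣n)
open import Data.Nat.Tactic.RingSolver using (solve-∀)
open import Data.Nat.Properties hiding (_≟_)
open import Data.Fin using (Fin; zero; suc; _≟_; toℕ; fromℕ<; punchOut)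
open import Data.Vec using (Vec; []; _∷_; lookup; tabulate)
open import Data.Vec.Properties using (lookup∘tabulate)
open import Function.Definitions using (Injective)
open import Data.Fin.Properties using (toℕ-injective; toℕ-fromℕ<; toℕ<n; any?; injective⇒≤; punchOut-injective) renaming (suc-injective to Fin-suc-injective)
open import Function using (_∘_)
open import Data.Product using (∃; Σ; _×_; _,_; proj₁; proj₂; uncurry)
open import Data.Sum using (_⊎_; inj₁; inj₂)
open import Data.Empty using (⊥-elim)
open import Relation.Nullary using (yes; no; does; contradiction)
open import Relation.Nullary.Decidable using (dec-true; dec-false)
open import Data.Bool using (Bool; true; false; if_then_else_)
open import Relation.Binary.PropositionalEquality
open import Algebra.Properties.CommutativeMonoid.Sum +-0-commutativeMonoid
  using (sum; sum-cong-≗; ∑-distrib-+; ∑-comm)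

sumF≡sum : ∀ {k} (f : Fin k → ℕ) → sumF f ≡ sum f
sumF≡sum {zero}  f = refl
sumF≡sum {suc k} f = cong (f zero +_) (sumF≡sum (λ i → f (suc i)))

sumF-cong : ∀ {k} {f g : Fin k → ℕ} → (∀ i → f i ≡ g i) → sumF f ≡ sumF g
sumF-cong {zero}  f≗g = refl
sumF-cong {suc k} f≗g = cong₂ _+_ (f≗g zero) (sumF-cong (λ i → f≗g (suc i)))

sumF-+ : ∀ {k} (f g : Fin k → ℕ) → sumF (λ i → f i + g i) ≡ sumF f + sumF g
sumF-+ f g = begin
  sumF (λ i → f i + g i)  ≡⟨ sumF≡sum (λ i → f i + g i) ⟩
  sum (λ i → f i + g i)   ≡⟨ ∑-distrib-+ f g ⟩
  sum f + sum g           ≡⟨ cong₂ _+_ (sumF≡sum f) (sumF≡sum g) ⟨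
  sumF f + sumF g         ∎
  where open ≡-Reasoning

sumF-swap : ∀ {k l} (f : Fin k → Fin l → ℕ) →
  sumF (λ i → sumF (f i)) ≡ sumF (λ j → sumF (λ i → f i j))
sumF-swap f = begin
  sumF (λ i → sumF (f i))          ≡⟨ sumF≡sum (λ i → sumF (f i)) ⟩
  sum (λ i → sumF (f i))           ≡⟨ sum-cong-≗ (λ i → sumF≡sum (f i)) ⟩
  sum (λ i → sum (f i))            ≡⟨ ∑-comm f ⟩
  sum (λ j → sum (λ i → f i j))    ≡⟨ sum-cong-≗ (λ j → sumF≡sum (λ i → f i j)) ⟨
  sum (λ j → sumF (λ i → f i j))   ≡⟨ sumF≡sum (λ j → sumF (λ i → f i j)) ⟨
  sumF (λ j → sumF (λ i → f i j))  ∎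
  where open ≡-Reasoning

sumF-zero : ∀ {k} {f : Fin k → ℕ} → (∀ i → f i ≡ 0) → sumF f ≡ 0
sumF-zero {zero}  f≗0 = refl
sumF-zero {suc k} f≗0 = cong₂ _+_ (f≗0 zero) (sumF-zero (λ i → f≗0 (suc i)))

term≤sumF : ∀ {k} (f : Fin k → ℕ) i → f i ≤ sumF f
term≤sumF f zero    = m≤m+n _ _
term≤sumF f (suc i) = ≤-trans (term≤sumF (λ j → f (suc j)) i) (m≤n+m _ _)

sumF-single : ∀ {k} (w : Fin k) (g : Fin k → ℕ) →
  (∀ u → u ≢ w → g u ≡ 0) → sumF g ≡ g w
sumF-single zero    g off = begin
  g zero + sumF (λ i → g (suc i))  ≡⟨ cong (g zero +_) (sumF-zero (λ i → off (suc i) (λ ()))) ⟩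
  g zero + 0                        ≡⟨ +-identityʳ (g zero) ⟩
  g zero                            ∎
  where open ≡-Reasoning
sumF-single (suc w) g off =
  cong₂ _+_ (off zero (λ ())) (sumF-single w (λ i → g (suc i)) (λ u u≢w → off (suc u) (u≢w ∘ Fin-suc-injective)))

sumF-select : ∀ {k} (c : Fin k → Bool) (g : Fin k → ℕ) (w : Fin k) →
  c w ≡ true → (∀ u → u ≢ w → c u ≡ false) →
  sumF (λ u → if c u then g u else 0) ≡ g w
sumF-select c g w cw≡true off = trans (sumF-single w _ unselected) selected
  where
  unselected : ∀ u → u ≢ w → (if c u then g u else 0) ≡ 0
  unselected u u≢w rewrite off u u≢w = refl
  selected : (if c w then g w else 0) ≡ g w
  selected rewrite cw≡true = refl

le-maxF : ∀ {k} (f : Fin k → ℕ) i → f i ≤ maxF f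
le-maxF f zero    = m≤m⊔n _ _
le-maxF f (suc i) = ≤-trans (le-maxF (λ j → f (suc j)) i) (m≤n⊔m _ _)

minF-le : ∀ {k} (f : Fin k → ℕ) i → minF f ≤ f i
minF-le {suc zero}    f zero    = ≤-refl
minF-le {suc (suc k)} f zero    = m⊓n≤m _ _
minF-le {suc (suc k)} f (suc i) = ≤-trans (m⊓n≤n _ _) (minF-le (λ j → f (suc j)) i)

gap≤discrepancy : ∀ {k} (x : Load k) u w → x u ∸ x w ≤ discrepancy x
gap≤discrepancy x u w = ∸-mono (le-maxF x u) (minF-le x w)

send-zero : ∀ {d} (A : Algorithm d) i → Algorithm.send A 0 i ≡ 0
send-zero A i = n≤0⇒n≡0 (≤-trans (term≤sumF (Algorithm.send A 0) i) (Algorithm.valid A 0))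

-- Every step preserves the total number of tokens: each token sent along
-- edge i of u is received by exactly one node, namely nbr u i.
step-conserves : ∀ {n d} (A : Algorithm d) (G : RegGraph n d) (x : Load n) →
  sumF (step A G x) ≡ sumF x
step-conserves {n} {d} A G x = begin
  sumF (step A G x)                      ≡⟨ sumF-+ kept received ⟩
  sumF kept + sumF received              ≡⟨ cong (sumF kept +_) received≡sent ⟩
  sumF kept + sumF sent                  ≡⟨ sumF-+ kept sent ⟨
  sumF (λ v → kept v + sent v)           ≡⟨ sumF-cong (λ v → m∸n+n≡m (valid (x v))) ⟩
  sumF x                                 ∎
  where
  open ≡-Reasoning
  open Algorithm A
  open RegGraph G
  sent kept : Load n
  sent v = sumF (send (x v))
  kept v = x v ∸ sent v
  along : Fin n → Fin d → Fin n → ℕ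
  along u i v = if does (nbr u i ≟ v) then send (x u) i else 0
  received : Load n
  received v = sumF (λ u → sumF (λ i → along u i v))
  arrives : ∀ u i → sumF (along u i) ≡ send (x u) i
  arrives u i = sumF-select (λ v → does (nbr u i ≟ v)) (λ _ → send (x u) i) (nbr u i)
    (dec-true (nbr u i ≟ nbr u i) refl) (λ v v≢nbr → dec-false (nbr u i ≟ v) (v≢nbr ∘ sym))
  received≡sent : sumF received ≡ sumF sent
  received≡sent = begin
    sumF (λ v → sumF (λ u → sumF (λ i → along u i v)))  ≡⟨ sumF-swap (λ v u → sumF (λ i → along u i v)) ⟩
    sumF (λ u → sumF (λ v → sumF (λ i → along u i v)))  ≡⟨ sumF-cong (λ u → sumF-swap (λ v i → along u i v)) ⟩
    sumF (λ u → sumF (λ i → sumF (along u i)))          ≡⟨ sumF-cong (λ u → sumF-cong (arrives u)) ⟩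
    sumF sent                                           ∎

run-conserves : ∀ {n d} (A : Algorithm d) (G : RegGraph n d) (x : Load n) t →
  sumF (run A G x t) ≡ sumF x
run-conserves A G x zero    = refl
run-conserves A G x (suc t) = trans (step-conserves A G (run A G x t)) (run-conserves A G x t)

positive-term : ∀ {k} (f : Fin k → ℕ) → 0 < sumF f → ∃ λ u → 0 < f u
positive-term {suc k} f 0<sum with f zero in eq
... | suc _ = zero , ≤-trans (s≤s z≤n) (≤-reflexive (sym eq))
... | zero  with positive-term (λ i → f (suc i)) 0<sum
...   | u , 0<fu = suc u , 0<fu

-- On at least two nodes, a single token always leaves discrepancy at least 1:
-- some node holds the token and one of the first two nodes holds nothing.
one-token : ∀ {k} (x : Load (suc (suc k))) → sumF x ≡ 1 → 1 ≤ discrepancy x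
one-token x sum≡1 with positive-term x (≤-reflexive (sym sum≡1)) | empty-node (x zero) (x (suc zero)) first-two≤1
  where
  first-two≤1 : x zero + x (suc zero) ≤ 1
  first-two≤1 = ≤-trans (+-monoʳ-≤ (x zero) (m≤m+n (x (suc zero)) _)) (≤-reflexive sum≡1)
  empty-node : ∀ a b → a + b ≤ 1 → a ≡ 0 ⊎ b ≡ 0
  empty-node zero    b       _ = inj₁ refl
  empty-node (suc a) zero    _ = inj₂ refl
  empty-node (suc a) (suc b) (s≤s a+1+b≤0) = ⊥-elim (m+1+n≢0 a (n≤0⇒n≡0 a+1+b≤0))
... | u , 0<xu | inj₁ x0≡0 = ≤-trans (subst (λ z → 1 ≤ x u ∸ z) (sym x0≡0) 0<xu) (gap≤discrepancy x u zero)
... | u , 0<xu | inj₂ x1≡0 = ≤-trans (subst (λ z → 1 ≤ x u ∸ z) (sym x1≡0) 0<xu) (gap≤discrepancy x u (suc zero))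

%-absorbˡ : ∀ x y n .{{_ : NonZero n}} → (x % n + y) % n ≡ (x + y) % n
%-absorbˡ x y n = begin
  (x % n + y) % n          ≡⟨ %-distribˡ-+ (x % n) y n ⟩
  (x % n % n + y % n) % n  ≡⟨ cong (λ z → (z + y % n) % n) (m%n%n≡m%n x n) ⟩
  (x % n + y % n) % n      ≡⟨ %-distribˡ-+ x y n ⟨
  (x + y) % n              ∎
  where open ≡-Reasoning

-- Circulant graphs: the nodes Fin n are the residues modulo n and port p of
-- every node v leads to v + δ p.  Such a graph is d-regular and simple as
-- soon as the shifts δ p are distinct non-zero residues closed under negation.
module Circulant (n : ℕ) .{{_ : NonZero n}} where

  infixl 6 _⊕_
  _⊕_ : Fin n → ℕ → Fin n
  v ⊕ a = (toℕ v + a) mod n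

  toℕ-⊕ : ∀ v a → toℕ (v ⊕ a) ≡ (toℕ v + a) % n
  toℕ-⊕ v a = toℕ-fromℕ< (m%n<n (toℕ v + a) n)

  ⊕-identityʳ : ∀ v → v ⊕ 0 ≡ v
  ⊕-identityʳ v = toℕ-injective (trans (toℕ-⊕ v 0)
    (trans (cong (_% n) (+-identityʳ (toℕ v))) (m<n⇒m%n≡m (toℕ<n v))))

  ⊕-assoc : ∀ v a b → v ⊕ a ⊕ b ≡ v ⊕ (a + b)
  ⊕-assoc v a b = toℕ-injective (begin
    toℕ (v ⊕ a ⊕ b)            ≡⟨ toℕ-⊕ (v ⊕ a) b ⟩
    (toℕ (v ⊕ a) + b) % n      ≡⟨ cong (λ z → (z + b) % n) (toℕ-⊕ v a) ⟩
    ((toℕ v + a) % n + b) % n  ≡⟨ %-absorbˡ (toℕ v + a) b n ⟩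
    (toℕ v + a + b) % n        ≡⟨ cong (_% n) (+-assoc (toℕ v) a b) ⟩
    (toℕ v + (a + b)) % n      ≡⟨ toℕ-⊕ v (a + b) ⟨
    toℕ (v ⊕ (a + b))          ∎)
    where open ≡-Reasoning

  toℕ-⊕-rotate : ∀ v a → a < n → toℕ (v ⊕ a ⊕ (n ∸ toℕ v)) ≡ a
  toℕ-⊕-rotate v a a<n = begin
    toℕ (v ⊕ a ⊕ (n ∸ toℕ v))          ≡⟨ cong toℕ (⊕-assoc v a (n ∸ toℕ v)) ⟩
    toℕ (v ⊕ (a + (n ∸ toℕ v)))        ≡⟨ toℕ-⊕ v (a + (n ∸ toℕ v)) ⟩
    (toℕ v + (a + (n ∸ toℕ v))) % n    ≡⟨ cong (_% n) (x+[y+z]≡y+[x+z] (toℕ v) a (n ∸ toℕ v)) ⟩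
    (a + (toℕ v + (n ∸ toℕ v))) % n    ≡⟨ cong (λ z → (a + z) % n) (m+[n∸m]≡n (<⇒≤ (toℕ<n v))) ⟩
    (a + n) % n                        ≡⟨ [m+n]%n≡m%n a n ⟩
    a % n                              ≡⟨ m<n⇒m%n≡m a<n ⟩
    a                                  ∎
    where
    open ≡-Reasoning
    x+[y+z]≡y+[x+z] : ∀ x y z → x + (y + z) ≡ y + (x + z)
    x+[y+z]≡y+[x+z] x y z = trans (sym (+-assoc x y z)) (trans (cong (_+ z) (+-comm x y)) (+-assoc y x z))

  ⊕-cancel : ∀ v {a b} → a < n → b < n → v ⊕ a ≡ v ⊕ b → a ≡ b
  ⊕-cancel v {a} {b} a<n b<n eq = begin
    a                          ≡⟨ toℕ-⊕-rotate v a a<n ⟨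
    toℕ (v ⊕ a ⊕ (n ∸ toℕ v))  ≡⟨ cong (λ w → toℕ (w ⊕ (n ∸ toℕ v))) eq ⟩
    toℕ (v ⊕ b ⊕ (n ∸ toℕ v))  ≡⟨ toℕ-⊕-rotate v b b<n ⟩
    b                          ∎
    where open ≡-Reasoning

  ⊕-inverse : ∀ v a → a ≤ n → v ⊕ a ⊕ (n ∸ a) ≡ v
  ⊕-inverse v a a≤n = toℕ-injective (begin
    toℕ (v ⊕ a ⊕ (n ∸ a))    ≡⟨ cong toℕ (⊕-assoc v a (n ∸ a)) ⟩
    toℕ (v ⊕ (a + (n ∸ a)))  ≡⟨ toℕ-⊕ v (a + (n ∸ a)) ⟩
    (toℕ v + (a + (n ∸ a))) % n ≡⟨ cong (λ z → (toℕ v + z) % n) (m+[n∸m]≡n a≤n) ⟩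
    (toℕ v + n) % n          ≡⟨ [m+n]%n≡m%n (toℕ v) n ⟩
    toℕ v % n                ≡⟨ m<n⇒m%n≡m (toℕ<n v) ⟩
    toℕ v                    ∎)
    where open ≡-Reasoning

  ⊕-preserves-mod : ∀ k .{{_ : NonZero k}} → k ∣ n → ∀ v {a} → k ∣ a → toℕ (v ⊕ a) % k ≡ toℕ v % k
  ⊕-preserves-mod k k∣n v {a} k∣a = begin
    toℕ (v ⊕ a) % k        ≡⟨ cong (_% k) (toℕ-⊕ v a) ⟩
    (toℕ v + a) % n % k    ≡⟨ m∣n⇒o%n%m≡o%m k n (toℕ v + a) k∣n ⟩
    (toℕ v + a) % k        ≡⟨ %-remove-+ʳ (toℕ v) k∣a ⟩
    toℕ v % k              ∎
    where open ≡-Reasoning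

  module Shifts {d : ℕ} (δ : Fin d → ℕ)
           (δ-positive : ∀ p → 0 < δ p) (δ<n : ∀ p → δ p < n)
           (δ-injective : ∀ p q → δ p ≡ δ q → p ≡ q)
           (δ-symmetric : ∀ p → ∃ λ q → δ q ≡ n ∸ δ p) where

    circulant : RegGraph n d
    circulant = record
      { nbr       = λ v p → v ⊕ δ p
      ; noLoop    = λ v p loop → <⇒≢ (δ-positive p)
                      (sym (⊕-cancel v (δ<n p) (>-nonZero⁻¹ n) (trans loop (sym (⊕-identityʳ v)))))
      ; injective = λ v p q eq → δ-injective p q (⊕-cancel v (δ<n p) (δ<n q) eq)
      ; symmetric = back
      }
      where
      back : ∀ v p → ∃ λ q → v ⊕ δ p ⊕ δ q ≡ v
      back v p with δ-symmetric p
      ... | q , δq≡n∸δp = q , trans (cong (v ⊕ δ p ⊕_) δq≡n∸δp) (⊕-inverse v (δ p) (<⇒≤ (δ<n p)))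

    _⊖_ : Fin n → Fin d → Fin n
    v ⊖ p = v ⊕ (n ∸ δ p)

    ⊖-reaches : ∀ v p → v ⊖ p ⊕ δ p ≡ v
    ⊖-reaches v p = begin
      v ⊕ (n ∸ δ p) ⊕ δ p              ≡⟨ cong (v ⊕ (n ∸ δ p) ⊕_) (m∸[m∸n]≡n (<⇒≤ (δ<n p))) ⟨
      v ⊕ (n ∸ δ p) ⊕ (n ∸ (n ∸ δ p))  ≡⟨ ⊕-inverse v (n ∸ δ p) (m∸n≤m n (δ p)) ⟩
      v                                ∎
      where open ≡-Reasoning

    ⊖-unique : ∀ u v p → u ⊕ δ p ≡ v → u ≡ v ⊖ p
    ⊖-unique u v p reach = trans (sym (⊕-inverse u (δ p) (<⇒≤ (δ<n p)))) (cong (_⊕ (n ∸ δ p)) reach)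

    module _ (A : Algorithm d) where
      open Algorithm A

      step-circulant : ∀ x v → step A circulant x v ≡
        (x v ∸ sumF (send (x v))) + sumF (λ p → send (x (v ⊖ p)) p)
      step-circulant x v = cong ((x v ∸ sumF (send (x v))) +_) (begin
        sumF (λ u → sumF (λ p → along u p))  ≡⟨ sumF-swap (λ u p → along u p) ⟩
        sumF (λ p → sumF (λ u → along u p))  ≡⟨ sumF-cong received ⟩
        sumF (λ p → send (x (v ⊖ p)) p)      ∎)
        where
        open ≡-Reasoning
        along : Fin n → Fin d → ℕ
        along u p = if does (u ⊕ δ p ≟ v) then send (x u) p else 0
        received : ∀ p → sumF (λ u → along u p) ≡ send (x (v ⊖ p)) p
        received p = sumF-select (λ u → does (u ⊕ δ p ≟ v)) (λ u → send (x u) p) (v ⊖ p)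
          (dec-true (v ⊖ p ⊕ δ p ≟ v) (⊖-reaches v p))
          (λ u u≢v⊖p → dec-false (u ⊕ δ p ≟ v) (u≢v⊖p ∘ ⊖-unique u v p))

      run-fixed : ∀ x → (∀ v p → send (x (v ⊖ p)) p ≡ send (x v) p) →
        ∀ t v → run A circulant x t v ≡ x v
      run-fixed x balanced zero    v = refl
      run-fixed x balanced (suc t) v = begin
        step A circulant y v                                   ≡⟨ step-circulant y v ⟩
        (y v ∸ sumF (send (y v))) + sumF (λ p → send (y (v ⊖ p)) p)
          ≡⟨ cong₂ (λ a b → (a ∸ sumF (send a)) + b) (run-fixed x balanced t v)
                   (sumF-cong (λ p → trans (cong (λ a → send a p) (run-fixed x balanced t (v ⊖ p))) (balanced v p))) ⟩
        (x v ∸ sumF (send (x v))) + sumF (send (x v))          ≡⟨ m∸n+n≡m (valid (x v)) ⟩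
        x v                                                    ∎
        where
        open ≡-Reasoning
        y : Load n
        y = run A circulant x t

-- An injective map from Fin d to itself is onto: otherwise it would inject
-- Fin d into the d-1 remaining values.
injective⇒surjective : ∀ {d} (f : Fin d → Fin d) → Injective _≡_ _≡_ f → ∀ t → ∃ λ p → f p ≡ t
injective⇒surjective {suc d} f f-injective t with any? (λ p → f p ≟ t)
... | yes hit  = hit
... | no  miss = contradiction (injective⇒≤ {f = avoid-t} avoid-t-injective) 1+n≰n
  where
  avoid-t : Fin (suc d) → Fin d
  avoid-t p = punchOut {i = t} {j = f p} (λ t≡fp → miss (p , sym t≡fp))
  avoid-t-injective : Injective _≡_ _≡_ avoid-t
  avoid-t-injective eq = f-injective (punchOut-injective {i = t} _ _ eq)

trues : ∀ {d} → Vec Bool d → ℕ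
trues []           = 0
trues (true  ∷ bs) = suc (trues bs)
trues (false ∷ bs) = trues bs

trues≤length : ∀ {d} (bs : Vec Bool d) → trues bs ≤ d
trues≤length []           = z≤n
trues≤length (true  ∷ bs) = s≤s (trues≤length bs)
trues≤length (false ∷ bs) = m≤n⇒m≤1+n (trues≤length bs)

-- slot bs i j p is the position of port p when the marked ports are numbered
-- i, i+1, ... and the unmarked ones j, j+1, ..., both in increasing order.
slot : ∀ {d} → Vec Bool d → ℕ → ℕ → Fin d → ℕ
slot (true  ∷ bs) i j zero    = i
slot (false ∷ bs) i j zero    = j
slot (true  ∷ bs) i j (suc p) = slot bs (suc i) j p
slot (false ∷ bs) i j (suc p) = slot bs i (suc j) p

slot-marked : ∀ {d} (bs : Vec Bool d) i j p → lookup bs p ≡ true →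
  i ≤ slot bs i j p × slot bs i j p < i + trues bs
slot-marked (true  ∷ bs) i j zero    refl = ≤-refl , m<m+n i z<s
slot-marked (true  ∷ bs) i j (suc p) marked with slot-marked bs (suc i) j p marked
... | i<s , s<1+i+t = <⇒≤ i<s , ≤-trans s<1+i+t (≤-reflexive (sym (+-suc i (trues bs))))
slot-marked (false ∷ bs) i j (suc p) marked = slot-marked bs i (suc j) p marked

slot-unmarked : ∀ {d} (bs : Vec Bool d) i j p → lookup bs p ≡ false →
  j ≤ slot bs i j p × slot bs i j p + trues bs < j + d
slot-unmarked {suc d} (false ∷ bs) i j zero refl =
  ≤-refl , ≤-trans (s≤s (+-monoʳ-≤ j (trues≤length bs))) (≤-reflexive (sym (+-suc j d)))
slot-unmarked {suc d} (true  ∷ bs) i j (suc p) unmarked with slot-unmarked bs (suc i) j p unmarked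
... | j≤s , s+t<j+d = j≤s , ≤-trans (≤-reflexive (+-suc _ (trues bs))) (≤-trans (s≤s s+t<j+d) (≤-reflexive (sym (+-suc j d))))
slot-unmarked {suc d} (false ∷ bs) i j (suc p) unmarked with slot-unmarked bs i (suc j) p unmarked
... | 1+j≤s , s+t<1+j+d = <⇒≤ 1+j≤s , ≤-trans s+t<1+j+d (≤-reflexive (sym (+-suc j d)))

slot-lower : ∀ {d} (bs : Vec Bool d) i j p → i ≤ j → i ≤ slot bs i j p
slot-lower bs i j p i≤j with lookup bs p in marking
... | true  = proj₁ (slot-marked bs i j p marking)
... | false = ≤-trans i≤j (proj₁ (slot-unmarked bs i j p marking))

-- If the marked slots lie below j, no other port shares the slot of port 0:
-- a marked port 0 has the least slot i, an unmarked one the least unmarked slot j.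
slot-head-unique : ∀ {d} b (bs : Vec Bool d) i j q → i + trues (b ∷ bs) ≤ j →
  slot (b ∷ bs) i j zero ≢ slot (b ∷ bs) i j (suc q)
slot-head-unique true bs i j q separated i≡s =
  1+n≰n (≤-trans (slot-lower bs (suc i) j q 1+i≤j) (≤-reflexive (sym i≡s)))
  where
  1+i≤j : suc i ≤ j
  1+i≤j = ≤-trans (s≤s (m≤m+n i (trues bs))) (≤-trans (≤-reflexive (sym (+-suc i (trues bs)))) separated)
slot-head-unique false bs i j q separated j≡s with lookup bs q in marking
... | true  = <⇒≱ (proj₂ (slot-marked bs i (suc j) q marking)) (≤-trans separated (≤-reflexive j≡s))
... | false = 1+n≰n (≤-trans (proj₁ (slot-unmarked bs i (suc j) q marking)) (≤-reflexive (sym j≡s)))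

slot-injective : ∀ {d} (bs : Vec Bool d) i j → i + trues bs ≤ j →
  ∀ p q → slot bs i j p ≡ slot bs i j q → p ≡ q
slot-injective (b ∷ bs) i j separated zero    zero    _  = refl
slot-injective (b ∷ bs) i j separated zero    (suc q) eq = ⊥-elim (slot-head-unique b bs i j q separated eq)
slot-injective (b ∷ bs) i j separated (suc p) zero    eq = ⊥-elim (slot-head-unique b bs i j p separated (sym eq))
slot-injective (true ∷ bs) i j separated (suc p) (suc q) eq =
  cong suc (slot-injective bs (suc i) j (≤-trans (≤-reflexive (sym (+-suc i (trues bs)))) separated) p q eq)
slot-injective (false ∷ bs) i j separated (suc p) (suc q) eq =
  cong suc (slot-injective bs i (suc j) (m≤n⇒m≤1+n separated) p q eq)

-- The ranking of the ports that puts the marked ports first: a permutation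
-- of Fin d sending the marked ports to the first trues bs positions.
module Ranking {d : ℕ} (bs : Vec Bool d) where

  rank< : ∀ p → slot bs 0 (trues bs) p < d
  rank< p with lookup bs p in marking
  ... | true  = ≤-trans (proj₂ (slot-marked bs 0 (trues bs) p marking)) (trues≤length bs)
  ... | false = +-cancelʳ-< (trues bs) _ _
                  (subst (slot bs 0 (trues bs) p + trues bs <_) (+-comm (trues bs) d)
                         (proj₂ (slot-unmarked bs 0 (trues bs) p marking)))

  rank : Fin d → Fin d
  rank p = fromℕ< (rank< p)

  toℕ-rank : ∀ p → toℕ (rank p) ≡ slot bs 0 (trues bs) p
  toℕ-rank p = toℕ-fromℕ< (rank< p)

  rank-injective : Injective _≡_ _≡_ rank
  rank-injective {p} {q} eq = slot-injective bs 0 (trues bs) ≤-refl p q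
    (trans (sym (toℕ-rank p)) (trans (cong toℕ eq) (toℕ-rank q)))

  rank-surjective : ∀ s → ∃ λ p → rank p ≡ s
  rank-surjective = injective⇒surjective rank rank-injective

  rank-marked : ∀ p → lookup bs p ≡ true → toℕ (rank p) < trues bs
  rank-marked p marked = subst (_< trues bs) (sym (toℕ-rank p)) (proj₂ (slot-marked bs 0 (trues bs) p marked))

-- Pair values: the even numbers 2E, 2(E-1), ..., 2 followed by the odd
-- numbers 1, 3, 5, ...  They are the positive shifts of the adversary's graph;
-- the first E of them are even.
pairValue : ℕ → ℕ → ℕ
pairValue zero    i       = suc (2 * i)
pairValue (suc E) zero    = 2 * suc E
pairValue (suc E) (suc i) = pairValue E i

pairValue-nonzero : ∀ E i → pairValue E i ≢ 0
pairValue-nonzero zero    i       ()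
pairValue-nonzero (suc E) zero    ()
pairValue-nonzero (suc E) (suc i) = pairValue-nonzero E i

pairValue-even : ∀ {E i} → i < E → 2 ∣ pairValue E i
pairValue-even {suc E} {zero}  _         = m∣m*n (suc E)
pairValue-even {suc E} {suc i} (s≤s i<E) = pairValue-even i<E

pairValue-evenRange : ∀ E i k → pairValue E i ≡ 2 * k → k ≤ E
pairValue-evenRange zero    i       k odd≡even = contradiction (sym odd≡even) (even≢odd k i)
pairValue-evenRange (suc E) zero    k eq       = ≤-reflexive (*-cancelˡ-≡ k (suc E) 2 (sym eq))
pairValue-evenRange (suc E) (suc i) k eq       = m≤n⇒m≤1+n (pairValue-evenRange E i k eq)

-- Distinct positions have distinct values (an even value 2(E+1) never recurs).
pairValue-injective : ∀ E {i j} → pairValue E i ≡ pairValue E j → i ≡ j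
pairValue-injective zero    {i}     {j}     eq = *-cancelˡ-≡ i j 2 (suc-injective eq)
pairValue-injective (suc E) {zero}  {zero}  eq = refl
pairValue-injective (suc E) {zero}  {suc j} eq = contradiction (pairValue-evenRange E j (suc E) (sym eq)) 1+n≰n
pairValue-injective (suc E) {suc i} {zero}  eq = contradiction (pairValue-evenRange E i (suc E) eq) 1+n≰n
pairValue-injective (suc E) {suc i} {suc j} eq = cong suc (pairValue-injective E eq)

pairValue-bound : ∀ E c {F} i → 2 * E ≤ F → 2 * c ≤ suc F → i < E + c → pairValue E i ≤ F
pairValue-bound zero    c i       _         2c≤1+F i<c =
  s≤s⁻¹ (≤-trans (≤-reflexive (sym (*-suc 2 i))) (≤-trans (*-monoʳ-≤ 2 i<c) 2c≤1+F))
pairValue-bound (suc E) c zero    2[1+E]≤F  _      _           = 2[1+E]≤F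
pairValue-bound (suc E) c (suc i) 2[1+E]≤F  2c≤1+F (s≤s i<E+c) =
  pairValue-bound E c i (≤-trans (*-monoʳ-≤ 2 (n≤1+n E)) 2[1+E]≤F) 2c≤1+F i<E+c

double≡+ : ∀ x → 2 * x ≡ x + x
double≡+ x = cong (x +_) (+-identityʳ x)

double-half≤ : ∀ x → 2 * ⌊ x /2⌋ ≤ x
double-half≤ zero          = z≤n
double-half≤ (suc zero)    = z≤n
double-half≤ (suc (suc x)) = ≤-trans (≤-reflexive (*-suc 2 ⌊ x /2⌋)) (s≤s (s≤s (double-half≤ x)))

≤1+double-half : ∀ x → x ≤ suc (2 * ⌊ x /2⌋)
≤1+double-half zero          = z≤n
≤1+double-half (suc zero)    = ≤-refl
≤1+double-half (suc (suc x)) = ≤-trans (s≤s (s≤s (≤1+double-half x))) (≤-reflexive (cong suc (sym (*-suc 2 ⌊ x /2⌋))))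

-- Slots s < h = ⌊d/2⌋ get the pair values b s ∈ [1, m), slot h + k gets the
-- opposite shift n - b k, and for odd d the last slot h + h gets m = n - m.
-- The first L = min(h, E) slots carry even shifts, and d ≤ 4L + 3.
module ShiftTable (m' d : ℕ) (d<n : d < suc m' * 2) where

  m n h E L : ℕ
  m = suc m'
  n = m * 2
  h = ⌊ d /2⌋
  E = ⌊ m' /2⌋
  L = h ⊓ E

  n≡m+m : n ≡ m + m
  n≡m+m = trans (*-comm m 2) (double≡+ m)

  h+h≤d : h + h ≤ d
  h+h≤d = ≤-trans (≤-reflexive (sym (double≡+ h))) (double-half≤ d)

  d≤1+h+h : d ≤ suc (h + h)
  d≤1+h+h = ≤-trans (≤1+double-half d) (≤-reflexive (cong suc (double≡+ h)))

  h<m : h < m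
  h<m = *-cancelˡ-< 2 h m (≤-<-trans (double-half≤ d) (<-≤-trans d<n (≤-reflexive (*-comm m 2))))

  b : ℕ → ℕ
  b = pairValue E

  -- The first h pair values lie in (0, m), since h ≤ m - 1 = E + ⌈(m-1)/2⌉.
  b-range : ∀ {k} → k < h → 0 < b k × b k < m
  b-range {k} k<h = n≢0⇒n>0 (pairValue-nonzero E k) ,
    s≤s (pairValue-bound E ⌈ m' /2⌉ k (double-half≤ m') (double-half≤ m)
          (<-≤-trans k<h (≤-trans (s≤s⁻¹ h<m) (≤-reflexive (sym (⌊n/2⌋+⌈n/2⌉≡n m'))))))

  reflect-range : ∀ {x} → 0 < x → x < m → m < n ∸ x × n ∸ x < n
  reflect-range {x} 0<x x<m =
    subst (λ z → m < z ∸ x) (sym n≡m+m) (subst (m <_) (sym (+-∸-assoc m (<⇒≤ x<m))) (m<m+n m (m<n⇒0<n∸m x<m))) ,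
    ∸-monoʳ-< 0<x (≤-trans (<⇒≤ x<m) (m≤m*n m 2))

  table : ℕ → ℕ
  table s with s <? h
  ... | yes _ = b s
  ... | no  _ with s <? h + h
  ...   | yes _ = n ∸ b (s ∸ h)
  ...   | no  _ = m

  table-low : ∀ {s} → s < h → table s ≡ b s
  table-low {s} s<h with s <? h
  ... | yes _   = refl
  ... | no  s≮h = contradiction s<h s≮h

  table-high : ∀ {k} → k < h → table (h + k) ≡ n ∸ b k
  table-high {k} k<h with h + k <? h
  ... | yes h+k<h = contradiction h+k<h (m+n≮m h k)
  ... | no  _ with h + k <? h + h
  ...   | yes _       = cong (λ z → n ∸ b z) (m+n∸m≡n h k)
  ...   | no  h+k≮h+h = contradiction (+-monoʳ-< h k<h) h+k≮h+h

  table-mid : table (h + h) ≡ m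
  table-mid with h + h <? h
  ... | yes h+h<h = contradiction h+h<h (m+n≮m h h)
  ... | no  _ with h + h <? h + h
  ...   | yes h+h<h+h = contradiction h+h<h+h (<-irrefl refl)
  ...   | no  _       = refl

  data Kind : ℕ → Set where
    low  : ∀ {s} → s < h → Kind s
    high : ∀ {k} → k < h → Kind (h + k)
    mid  : Kind (h + h)

  kind : ∀ s → s < d → Kind s
  kind s s<d with s <? h
  ... | yes s<h = low s<h
  ... | no  s≮h with m≤n⇒m<n∨m≡n (s≤s⁻¹ (<-≤-trans s<d d≤1+h+h))
  ...   | inj₂ refl  = mid
  ...   | inj₁ s<h+h = subst Kind (m+[n∸m]≡n h≤s) (high (+-cancelˡ-< h _ _ (subst (_< h + h) (sym (m+[n∸m]≡n h≤s)) s<h+h)))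
    where
    h≤s : h ≤ s
    h≤s = ≮⇒≥ s≮h

  m<n : m < n
  m<n = subst (m <_) (sym n≡m+m) (m<m+n m z<s)

  low-below : ∀ {s} → s < h → table s < m
  low-below s<h = subst (_< m) (sym (table-low s<h)) (proj₂ (b-range s<h))

  high-above : ∀ {k} → k < h → m < table (h + k) × table (h + k) < n
  high-above k<h = subst (λ z → m < z × z < n) (sym (table-high k<h))
                     (reflect-range (proj₁ (b-range k<h)) (proj₂ (b-range k<h)))

  b≤n : ∀ {k} → k < h → b k ≤ n
  b≤n k<h = <⇒≤ (<-trans (proj₂ (b-range k<h)) m<n)

  table-positive : ∀ {s} → s < d → 0 < table s
  table-positive {s} s<d with kind s s<d
  ... | low s<h  = subst (0 <_) (sym (table-low s<h)) (proj₁ (b-range s<h))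
  ... | high k<h = <-trans z<s (proj₁ (high-above k<h))
  ... | mid      = subst (0 <_) (sym table-mid) z<s

  table<n : ∀ {s} → s < d → table s < n
  table<n {s} s<d with kind s s<d
  ... | low s<h  = <-trans (low-below s<h) m<n
  ... | high k<h = proj₂ (high-above k<h)
  ... | mid      = subst (_< n) (sym table-mid) m<n

  -- Low values lie below m, high values above m, and the middle value is m.
  table-injective : ∀ {s t} → s < d → t < d → table s ≡ table t → s ≡ t
  table-injective {s} {t} s<d t<d eq with kind s s<d | kind t t<d
  ... | low s<h  | low t<h  = pairValue-injective E (trans (sym (table-low s<h)) (trans eq (table-low t<h)))
  ... | high k<h | high l<h = cong (h +_) (pairValue-injective E (∸-cancelˡ-≡ (b≤n k<h) (b≤n l<h)
                                 (trans (sym (table-high k<h)) (trans eq (table-high l<h)))))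
  ... | mid      | mid      = refl
  ... | low s<h  | high l<h = contradiction (<-trans (low-below s<h) (proj₁ (high-above l<h))) (<-irrefl eq)
  ... | high k<h | low t<h  = contradiction (<-trans (low-below t<h) (proj₁ (high-above k<h))) (<-irrefl (sym eq))
  ... | low s<h  | mid      = contradiction (low-below s<h) (<-irrefl (trans eq table-mid))
  ... | mid      | low t<h  = contradiction (low-below t<h) (<-irrefl (trans (sym eq) table-mid))
  ... | high k<h | mid      = contradiction (proj₁ (high-above k<h)) (<-irrefl (trans (sym table-mid) (sym eq)))
  ... | mid      | high l<h = contradiction (proj₁ (high-above l<h)) (<-irrefl (trans (sym table-mid) eq))

  -- Slots s < h and h + s carry opposite shifts; the middle shift m is its own opposite.
  table-symmetric : ∀ {s} → s < d → ∃ λ t → t < d × table t ≡ n ∸ table s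
  table-symmetric {s} s<d with kind s s<d
  ... | low s<h  = h + s , <-≤-trans (+-monoʳ-< h s<h) h+h≤d ,
                   trans (table-high s<h) (cong (n ∸_) (sym (table-low s<h)))
  ... | high {k} k<h = k , <-≤-trans k<h (≤-trans (m≤m+n h h) h+h≤d) ,
                   trans (table-low k<h) (sym (trans (cong (n ∸_) (table-high k<h)) (m∸[m∸n]≡n (b≤n k<h))))
  ... | mid      = h + h , s<d , trans table-mid (sym (trans (cong (n ∸_) table-mid) n∸m≡m))
    where
    n∸m≡m : n ∸ m ≡ m
    n∸m≡m = trans (cong (_∸ m) n≡m+m) (m+n∸m≡n m m)

  table-even : ∀ {s} → s < L → 2 ∣ table s
  table-even s<L = subst (2 ∣_) (sym (table-low (<-≤-trans s<L (m⊓n≤m h E))))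
                     (pairValue-even (<-≤-trans s<L (m⊓n≤n h E)))

  d≤3+4L : d ≤ 3 + 4 * L
  d≤3+4L = ≤-trans (⊓-glb via-h via-E) (≤-reflexive (sym (trans (cong (3 +_) (*-distribˡ-⊓ 4 h E)) (+-distribˡ-⊓ 3 (4 * h) (4 * E)))))
    where
    via-h : d ≤ 3 + 4 * h
    via-h = ≤-trans d≤1+h+h (≤-trans (m≤m+n _ (2 + 2 * h)) (≤-reflexive (eq h)))
      where
      eq : ∀ x → suc (x + x) + (2 + 2 * x) ≡ 3 + 4 * x
      eq = solve-∀
    via-E : d ≤ 3 + 4 * E
    via-E = ≤-trans (s≤s⁻¹ d<n) (≤-trans (s≤s (*-monoˡ-≤ 2 (≤1+double-half m'))) (≤-reflexive (eq E)))
      where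
      eq : ∀ x → suc (suc (2 * x) * 2) ≡ 3 + 4 * x
      eq = solve-∀

positive : ℕ → Bool
positive zero    = false
positive (suc _) = true

trues-positive≤sumF : ∀ {k} (g : Fin k → ℕ) → trues (tabulate (λ p → positive (g p))) ≤ sumF g
trues-positive≤sumF {zero}  g = z≤n
trues-positive≤sumF {suc k} g with g zero
... | zero  = trues-positive≤sumF (λ p → g (suc p))
... | suc _ = s≤s (≤-trans (trues-positive≤sumF (λ p → g (suc p))) (m≤n+m _ _))

unmarked⇒zero : ∀ x → positive x ≡ false → x ≡ 0
unmarked⇒zero zero _ = refl

degree≤7·discrepancy : ∀ {d L D} → d ≤ 3 + 4 * L → 1 ≤ D → L ≤ D → 1 * d ≤ 7 * D
degree≤7·discrepancy {d} {L} {D} d≤3+4L 1≤D L≤D = begin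
  1 * d          ≡⟨ *-identityˡ d ⟩
  d              ≤⟨ d≤3+4L ⟩
  3 + 4 * L      ≤⟨ +-mono-≤ (*-monoʳ-≤ 3 1≤D) (*-monoʳ-≤ 4 L≤D) ⟩
  3 * D + 4 * D  ≡⟨ *-distribʳ-+ D 3 4 ⟨
  7 * D          ∎
  where open ≤-Reasoning

-- A node holding
-- L tokens sends along at most L ports ("busy" ports).  The ports are ranked
-- so that busy ports come first and get the even shifts of the table.  Then
-- the configuration with L tokens on each even node and none on odd nodes is
-- a fixed point: tokens only travel along even shifts between loaded nodes,
-- and every loaded node receives on each port what it sends on that port.
module Adversary (m' d : ℕ) (d<n : d < suc m' * 2) (A : Algorithm d) where
  open ShiftTable m' d d<n
  open Algorithm A

  busy : Vec Bool d
  busy = tabulate (λ p → positive (send L p))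

  open Ranking busy

  busy≤L : trues busy ≤ L
  busy≤L = ≤-trans (trues-positive≤sumF (send L)) (valid L)

  shift : Fin d → ℕ
  shift p = table (toℕ (rank p))

  shift-injective : ∀ p q → shift p ≡ shift q → p ≡ q
  shift-injective p q eq = rank-injective (toℕ-injective (table-injective (toℕ<n (rank p)) (toℕ<n (rank q)) eq))

  shift-symmetric : ∀ p → ∃ λ q → shift q ≡ n ∸ shift p
  shift-symmetric p with table-symmetric (toℕ<n (rank p))
  ... | t , t<d , opposite with rank-surjective (fromℕ< t<d)
  ...   | q , rank-q≡t = q , trans (cong table (trans (cong toℕ rank-q≡t) (toℕ-fromℕ< t<d))) opposite

  open Circulant n
  open Shifts shift (λ p → table-positive (toℕ<n (rank p))) (λ p → table<n (toℕ<n (rank p)))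
    shift-injective shift-symmetric

  G : RegGraph n d
  G = circulant

  evenLoad : ℕ → ℕ
  evenLoad zero    = L
  evenLoad (suc _) = 0

  x₀ : Load n
  x₀ v = evenLoad (toℕ v % 2)

  -- Busy ports preserve parity, and idle ports carry nothing from either load.
  balanced : ∀ v p → send (x₀ (v ⊖ p)) p ≡ send (x₀ v) p
  balanced v p = by-marking (lookup busy p) refl
    where
    by-marking : ∀ b → lookup busy p ≡ b → send (x₀ (v ⊖ p)) p ≡ send (x₀ v) p
    by-marking true  marked =
      cong (λ r → send (evenLoad r) p) (⊕-preserves-mod 2 (n∣m*n m) v 2∣n∸shift)
      where
      2∣shift : 2 ∣ shift p
      2∣shift = table-even (<-≤-trans (rank-marked p marked) busy≤L)
      2∣n∸shift : 2 ∣ n ∸ shift p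
      2∣n∸shift = ∣m+n∣m⇒∣n (subst (2 ∣_) (sym (m+[n∸m]≡n (<⇒≤ (table<n (toℕ<n (rank p)))))) (n∣m*n m)) 2∣shift
    by-marking false unmarked = trans (idle (v ⊖ p)) (sym (idle v))
      where
      idle-at-L : send L p ≡ 0
      idle-at-L = unmarked⇒zero (send L p) (trans (sym (lookup∘tabulate _ p)) unmarked)
      idle : ∀ w → send (x₀ w) p ≡ 0
      idle w with toℕ w % 2
      ... | zero  = idle-at-L
      ... | suc _ = send-zero A p

  fixed : ∀ t v → run A G x₀ t v ≡ x₀ v
  fixed = run-fixed A x₀ balanced

  stuck : ∀ t → L ≤ discrepancy (run A G x₀ t)
  stuck t = subst₂ (λ a b → a ∸ b ≤ discrepancy (run A G x₀ t)) (fixed t zero) (fixed t (suc zero))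
              (gap≤discrepancy (run A G x₀ t) zero (suc zero))

  x₁ : Load n
  x₁ zero    = 1
  x₁ (suc _) = 0

  lonely : ∀ t → 1 ≤ discrepancy (run A G x₁ t)
  lonely t = one-token (run A G x₁ t)
    (trans (run-conserves A G x₁ t) (cong suc (sumF-zero {f = λ v → x₁ (suc (suc v))} (λ _ → refl))))

  configuration : ∃ λ (x : Load n) → ∀ t → 1 ≤ discrepancy (run A G x t) × L ≤ discrepancy (run A G x t)
  configuration = by-size L refl
    where
    by-size : ∀ l → L ≡ l → ∃ λ (x : Load n) → ∀ t → 1 ≤ discrepancy (run A G x t) × L ≤ discrepancy (run A G x t)
    by-size zero    L≡0   = x₁ , λ t → lonely t , ≤-trans (≤-reflexive L≡0) z≤n
    by-size (suc l) L≡1+l = x₀ , λ t → ≤-trans (≤-trans (s≤s z≤n) (≤-reflexive (sym L≡1+l))) (stuck t) , stuck t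

  lower-bound : Σ (RegGraph n d) λ H → ∃ λ (x : Load n) → ∀ t → 1 * d ≤ 7 * discrepancy (run A H x t)
  lower-bound = G , proj₁ configuration , λ t → uncurry (degree≤7·discrepancy d≤3+4L) (proj₂ configuration t)

theorem4 : ∃ λ (p : ℕ) → ∃ λ (q : ℕ) → 0 < p × 0 < q ×
    (∀ (n d : ℕ) → 2 ∣ n → d < n → (A : Algorithm d) →
      Σ (RegGraph n d) λ G → ∃ λ (x₀ : Load n) →
        ∀ (t : ℕ) → p * d ≤ q * discrepancy (run A G x₀ t))
theorem4 = 1 , 7 , z<s , z<s , adversary
  where
  adversary : ∀ n d → 2 ∣ n → d < n → (A : Algorithm d) →
    Σ (RegGraph n d) λ G → ∃ λ (x₀ : Load n) → ∀ t → 1 * d ≤ 7 * discrepancy (run A G x₀ t)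
  adversary _ d (divides zero    refl) ()  A
  adversary _ d (divides (suc m') refl) d<n A = Adversary.lower-bound m' d d<n A
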